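{- Let $m\ge0$ be even and $m'=m+1$. For each integer $p$, the number of self twin parsimonious games with $m'+4$ players, odd-length free type representation and pivot $p+1$ equals the number of self twin parsimonious games with $m+4$ players, odd-length free type representation and pivot $p$. In particular, the distinct pivot values in generation $m'$, in increasing order, are $x'_{m',c}=x_{m,c}+1$, where $x_{m,c}$ are those of generation $m$, with the same multiplicities.
   Context: Parsimonious (P) games: constant-sum homogeneous weighted majority games on $n$ players, without dummies and without dictator, having exactly $n$ minimal winning coalitions (homogeneous: weights $\mathbf w$, quota $q$, $S$ winning iff $\sum_{i\in S}w_i\ge q$, with equality for every minimal winning $S$). Each has a unique minimal homogeneous representation with integer weights $1=w_1\le\dots\le w_n$. Binary representation: $\mathbf b\in\{0,1\}^n$, $b_1=1$, $b_i=1$ iff $w_i>w_{i-1}$. Known: $b_1=1,b_2=0,b_{n-1}=0,b_n=1$ always, and $(b_3,\dots,b_{n-2})$ determines the game, every vector in $\{0,1\}^{n-4}$ arising. The number of types $h$ is the number of distinct weights; the type representation is $(x_1,\dots,x_h)$, $x_t$ the number of players with the $t$-th smallest distinct weight; the free type representation is $(x_1,\dots,x_{h-1})$. A P game is self twin if $b_i=b_{n+1-i}$ for $i=3,\dots,n-2$. When $h-1$ is odd, the middle component $x_{h/2}$ is called the pivot. "Generation $m$" means games with $m+4$ players. -}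

module Defs where

open import Data.Bool using (Bool; true; false)
import Data.Bool.Properties as BoolP
open import Data.Nat using (ℕ; zero; suc; _*_; _/_; _%_)
import Data.Nat.Properties as NatP
open import Data.Integer using (ℤ; +_)
import Data.Integer.Properties as IntP
open import Data.List using (List; []; _∷_; _++_; length; map; filter; concatMap)
open import Data.Vec using (Vec; []; _∷_; toList; reverse)
import Data.Vec.Properties as VecP
open import Data.Product using (_×_; ∃)
open import Relation.Binary.PropositionalEquality using (_≡_)
open import Relation.Nullary using (Dec)
open import Relation.Nullary.Decidable using (_×-dec_)

Even : ℕ → Set
Even m = ∃ λ k → m ≡ 2 * k

allVecs : (m : ℕ) → List (Vec Bool m)
allVecs zero    = [] ∷ []
allVecs (suc m) = concatMap (λ v → (false ∷ v) ∷ (true ∷ v) ∷ []) (allVecs m)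

-- A P game of generation m (m+4 players) is determined by the free middle
-- part c = (b_3,...,b_{m+2}) ∈ {0,1}^m of its binary representation;
-- the full binary representation is b = (1,0,c,0,1).
binaryRep : {m : ℕ} → Vec Bool m → List Bool
binaryRep c = true ∷ false ∷ (toList c ++ (false ∷ true ∷ []))

-- Block lengths of a binary representation: each 1 starts a new type.
-- typeRepAux k bs : k = size of the current (open) block.
typeRepAux : ℕ → List Bool → List ℕ
typeRepAux k []           = k ∷ []
typeRepAux k (true ∷ bs)  = k ∷ typeRepAux 1 bs
typeRepAux k (false ∷ bs) = typeRepAux (suc k) bs

typeRepOfBinary : List Bool → List ℕ
typeRepOfBinary []           = []
typeRepOfBinary (true ∷ bs)  = typeRepAux 1 bs
typeRepOfBinary (false ∷ bs) = []   -- never used: b_1 = 1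

dropLast : {A : Set} → List A → List A
dropLast []           = []
dropLast (x ∷ [])     = []
dropLast (x ∷ y ∷ xs) = x ∷ dropLast (y ∷ xs)

typeRep : {m : ℕ} → Vec Bool m → List ℕ
typeRep c = typeRepOfBinary (binaryRep c)

freeTypeRep : {m : ℕ} → Vec Bool m → List ℕ
freeTypeRep c = dropLast (typeRep c)

-- Self twin: b_i = b_{n+1-i} for i = 3..n-2, i.e. c is a palindrome.
SelfTwin : {m : ℕ} → Vec Bool m → Set
SelfTwin c = reverse c ≡ c

OddFree : {m : ℕ} → Vec Bool m → Set
OddFree c = length (freeTypeRep c) % 2 ≡ 1

nth : ℕ → List ℕ → ℕ
nth _       []       = 0
nth zero    (x ∷ xs) = x
nth (suc i) (x ∷ xs) = nth i xs

-- Pivot: the middle component x_{h/2} of the free type representation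
-- (1-indexed position h/2 = (length+1)/2, i.e. 0-indexed position length/2).
pivot : {m : ℕ} → Vec Bool m → ℕ
pivot c = nth (length (freeTypeRep c) / 2) (freeTypeRep c)

Counted : {m : ℕ} → ℤ → Vec Bool m → Set
Counted p c = SelfTwin c × OddFree c × (+ pivot c ≡ p)

Counted? : {m : ℕ} (p : ℤ) (c : Vec Bool m) → Dec (Counted p c)
Counted? p c =
  VecP.≡-dec BoolP._≟_ (reverse c) c
  ×-dec (length (freeTypeRep c) % 2 NatP.≟ 1)
  ×-dec (+ pivot c IntP.≟ p)

countPivot : ℕ → ℤ → ℕ
countPivot m p = length (filter (Counted? p) (allVecs m))

SelfTwinOdd? : {m : ℕ} (c : Vec Bool m) → Dec (SelfTwin c × OddFree c)
SelfTwinOdd? c =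
  VecP.≡-dec BoolP._≟_ (reverse c) c
  ×-dec (length (freeTypeRep c) % 2 NatP.≟ 1)

pivots : ℕ → List ℕ
pivots m = map pivot (filter SelfTwinOdd? (allVecs m))

module Submission where

-- A P game of generation n is its vector c of middle bits, and its free type
-- representation lists the block sizes of the word 1 0 c 0 (a block starts at
-- every 1).  Self twin means c is a palindrome, so c = v w v^R with |w| ≤ 1.
--   * Block structure: the free types of a word, their number (1 + the number
--     of 1s) and the middle one when both halves carry equally many 1s.
--   * Generation 2k: the self twin games are exactly v v^R, all with an odd
--     number of free types.  Generation 2k + 1: they are v b v^R, and b = 1
--     gives an even number of free types, so exactly v 0 v^R remain; the 0
--     lengthens the central block, raising the pivot by one.
--   * Enumeration: both generations are therefore listed, up to permutation,
--     by v ↦ v v^R and v ↦ v 0 v^R over {0,1}^k, which gives the statement on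
--     pivots; counting occurrences is invariant under permutation, giving the
--     statement on the numbers of games.

open import Defs

open import Data.Bool using (Bool; true; false)
open import Data.Empty using (⊥-elim)
open import Data.Nat using (ℕ; zero; suc; _+_; _/_; _%_; s≤s; z≤n)
open import Data.Nat.Properties using (+-suc; +-comm; +-identityʳ; 0≢1+n)
open import Data.Nat.DivMod using (m/n≡1+[m∸n]/n)
open import Data.Integer as ℤ using (ℤ; +_; 1ℤ)
import Data.Integer.Properties as ℤ
open import Data.List as List using (List; []; _∷_; [_]; length; map; filter)
import Data.List.Properties as List
open import Data.Vec as Vec using (Vec; []; _∷_; toList; reverse)
import Data.Vec.Properties as Vec
open import Data.Vec.Relation.Binary.Equality.Cast using (cast-is-id)
open import Data.Product using (_×_; _,_; ∃; ∃₂; proj₁; proj₂; assocˡ′; assocʳ′)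
open import Relation.Binary.PropositionalEquality hiding ([_])
open import Relation.Nullary using (¬_; yes; no)
open import Relation.Nullary.Decidable using (_×-dec_)
open import Function using (_∘′_; case_of_)
open import Function.Bundles using (mk⇔)
open import Function.Definitions using (Injective)
open import Relation.Unary using (Decidable; _≐_)
open import Data.List.Membership.Propositional using (_∈_)
open import Data.List.Membership.Propositional.Properties
  using (∈-filter⁺; ∈-filter⁻; ∈-map⁺; ∈-map⁻; ∈-concatMap⁺; ∈-concatMap⁻)
open import Data.List.Membership.Propositional.Properties.WithK using (unique∧set⇒bag)
open import Data.List.Relation.Unary.Any as Any using (here; there)
open import Data.List.Relation.Unary.All using (All; []; _∷_)
open import Data.List.Relation.Unary.All.Properties using (¬Any⇒All¬; All¬⇒¬Any)
open import Data.List.Relation.Unary.AllPairs using ([]; _∷_)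
open import Data.List.Relation.Unary.Unique.Propositional using (Unique)
import Data.List.Relation.Unary.Unique.Propositional.Properties as Unique
open import Data.List.Relation.Binary.BagAndSetEquality using (∼bag⇒↭)
open import Data.List.Relation.Binary.Permutation.Propositional using (_↭_; module PermutationReasoning)
open import Data.List.Relation.Binary.Permutation.Propositional.Properties using (map⁺; ↭-length; filter-↭)

blocks : ℕ → List Bool → List ℕ
blocks j []           = []
blocks j (true ∷ bs)  = j ∷ blocks 1 bs
blocks j (false ∷ bs) = blocks (suc j) bs

openBlock : ℕ → List Bool → ℕ
openBlock j []           = j
openBlock j (true ∷ bs)  = openBlock 1 bs
openBlock j (false ∷ bs) = openBlock (suc j) bs

typeRepAux-++ : ∀ j xs ys →
  typeRepAux j (xs List.++ ys) ≡ blocks j xs List.++ typeRepAux (openBlock j xs) ys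
typeRepAux-++ j []           ys = refl
typeRepAux-++ j (true ∷ xs)  ys = cong (j ∷_) (typeRepAux-++ 1 xs ys)
typeRepAux-++ j (false ∷ xs) ys = typeRepAux-++ (suc j) xs ys

-- The closed blocks of bs followed by the final block, which the trailing
-- bits 0,1 of the binary representation enlarge by one.
shape : ℕ → List Bool → List ℕ
shape j bs = blocks j bs List.++ [ suc (openBlock j bs) ]

shape-++ : ∀ j xs ys → shape j (xs List.++ ys) ≡ blocks j xs List.++ shape (openBlock j xs) ys
shape-++ j []           ys = refl
shape-++ j (true ∷ xs)  ys = cong (j ∷_) (shape-++ 1 xs ys)
shape-++ j (false ∷ xs) ys = shape-++ (suc j) xs ys

-- The free type representation as a function of the middle bits
-- c = (b_3,...,b_{n-2}); by definition freeTypeRep c = freeTypes (toList c).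
freeTypes : List Bool → List ℕ
freeTypes bs = dropLast (typeRepAux 2 (bs List.++ false ∷ true ∷ []))

dropLast-++ : ∀ {A : Set} (xs : List A) a b → dropLast (xs List.++ a ∷ b ∷ []) ≡ xs List.++ [ a ]
dropLast-++ []           a b = refl
dropLast-++ (x ∷ [])     a b = refl
dropLast-++ (x ∷ y ∷ xs) a b = cong (x ∷_) (dropLast-++ (y ∷ xs) a b)

-- Closed form of the free type representation: the last type (the block of
-- the final bit 1) is dropped, leaving the block sizes of 1,0,bs,0.
freeTypes-shape : ∀ bs → freeTypes bs ≡ shape 2 bs
freeTypes-shape bs = begin
  dropLast (typeRepAux 2 (bs List.++ false ∷ true ∷ []))
    ≡⟨ cong dropLast (typeRepAux-++ 2 bs (false ∷ true ∷ [])) ⟩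
  dropLast (blocks 2 bs List.++ suc (openBlock 2 bs) ∷ 1 ∷ [])
    ≡⟨ dropLast-++ (blocks 2 bs) (suc (openBlock 2 bs)) 1 ⟩
  shape 2 bs ∎
  where open ≡-Reasoning

ones : List Bool → ℕ
ones []           = 0
ones (true ∷ bs)  = suc (ones bs)
ones (false ∷ bs) = ones bs

ones-++ : ∀ xs ys → ones (xs List.++ ys) ≡ ones xs + ones ys
ones-++ []           ys = refl
ones-++ (true ∷ xs)  ys = cong suc (ones-++ xs ys)
ones-++ (false ∷ xs) ys = ones-++ xs ys

ones-reverse : ∀ xs → ones (List.reverse xs) ≡ ones xs
ones-reverse []       = refl
ones-reverse (x ∷ xs) = begin
  ones (List.reverse (x ∷ xs))        ≡⟨ cong ones (List.unfold-reverse x xs) ⟩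
  ones (List.reverse xs List.++ [ x ]) ≡⟨ ones-++ (List.reverse xs) [ x ] ⟩
  ones (List.reverse xs) + ones [ x ]  ≡⟨ cong (_+ ones [ x ]) (ones-reverse xs) ⟩
  ones xs + ones [ x ]                 ≡⟨ +-comm (ones xs) (ones [ x ]) ⟩
  ones [ x ] + ones xs                 ≡⟨ ones-++ [ x ] xs ⟨
  ones (x ∷ xs)                        ∎
  where open ≡-Reasoning

length-blocks : ∀ j bs → length (blocks j bs) ≡ ones bs
length-blocks j []           = refl
length-blocks j (true ∷ bs)  = cong suc (length-blocks 1 bs)
length-blocks j (false ∷ bs) = length-blocks (suc j) bs

length-shape : ∀ j bs → length (shape j bs) ≡ suc (ones bs)
length-shape j []           = refl
length-shape j (true ∷ bs)  = cong suc (length-shape 1 bs)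
length-shape j (false ∷ bs) = length-shape (suc j) bs

length-shape-++ : ∀ j xs ys → length (shape j (xs List.++ ys)) ≡ ones xs + suc (ones ys)
length-shape-++ j xs ys = begin
  length (shape j (xs List.++ ys))
    ≡⟨ cong length (shape-++ j xs ys) ⟩
  length (blocks j xs List.++ shape (openBlock j xs) ys)
    ≡⟨ List.length-++ (blocks j xs) ⟩
  length (blocks j xs) + length (shape (openBlock j xs) ys)
    ≡⟨ cong₂ _+_ (length-blocks j xs) (length-shape (openBlock j xs) ys) ⟩
  ones xs + suc (ones ys) ∎
  where open ≡-Reasoning

odd-half : ∀ a → (a + suc a) / 2 ≡ a
odd-half zero    = refl
odd-half (suc a) = begin
  suc (a + suc (suc a)) / 2   ≡⟨ cong (λ n → suc n / 2) (+-suc a (suc a)) ⟩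
  suc (suc (a + suc a)) / 2   ≡⟨ m/n≡1+[m∸n]/n {m = suc (suc (a + suc a))} {n = 2} (s≤s (s≤s z≤n)) ⟩
  suc ((a + suc a) / 2)       ≡⟨ cong suc (odd-half a) ⟩
  suc a                       ∎
  where open ≡-Reasoning

odd-parity : ∀ a → (a + suc a) % 2 ≡ 1
odd-parity zero    = refl
odd-parity (suc a) = trans (cong (λ n → suc n % 2) (+-suc a (suc a))) (odd-parity a)

even-parity : ∀ a → (a + suc (suc a)) % 2 ≡ 0
even-parity zero    = refl
even-parity (suc a) = trans (cong (λ n → suc n % 2) (+-suc a (suc (suc a)))) (even-parity a)

middle : List ℕ → ℕ
middle xs = nth (length xs / 2) xs

nth-++ : ∀ xs ys → nth (length xs) (xs List.++ ys) ≡ nth 0 ys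
nth-++ []       ys = refl
nth-++ (x ∷ xs) ys = nth-++ xs ys

firstBlock : ℕ → List Bool → ℕ
firstBlock j bs = nth 0 (shape j bs)

firstBlock-suc : ∀ j bs → firstBlock (suc j) bs ≡ suc (firstBlock j bs)
firstBlock-suc j []           = refl
firstBlock-suc j (true ∷ bs)  = refl
firstBlock-suc j (false ∷ bs) = firstBlock-suc (suc j) bs

middle-balanced : ∀ xs ys → ones ys ≡ ones xs →
  middle (shape 2 (xs List.++ ys)) ≡ firstBlock (openBlock 2 xs) ys
middle-balanced xs ys balanced = begin
  nth (length S / 2) S                  ≡⟨ cong (λ i → nth i S) half ⟩
  nth (length B) S                      ≡⟨ cong (nth (length B)) (shape-++ 2 xs ys) ⟩
  nth (length B) (B List.++ shape o ys) ≡⟨ nth-++ B (shape o ys) ⟩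
  firstBlock o ys                       ∎
  where
  open ≡-Reasoning
  o = openBlock 2 xs
  B = blocks 2 xs
  S = shape 2 (xs List.++ ys)
  half : length S / 2 ≡ length B
  half = begin
    length S / 2                  ≡⟨ cong (_/ 2) (length-shape-++ 2 xs ys) ⟩
    (ones xs + suc (ones ys)) / 2 ≡⟨ cong (λ n → (ones xs + suc n) / 2) balanced ⟩
    (ones xs + suc (ones xs)) / 2 ≡⟨ odd-half (ones xs) ⟩
    ones xs                       ≡⟨ length-blocks 2 xs ⟨
    length B                      ∎

mirror : ∀ {j k} → Vec Bool j → Vec Bool k → Vec Bool (k + (j + k))
mirror w v = v Vec.++ (w Vec.++ reverse v)

toList-mirror : ∀ {j k} (w : Vec Bool j) (v : Vec Bool k) →
  toList (mirror w v) ≡ toList v List.++ (toList w List.++ List.reverse (toList v))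
toList-mirror w v = begin
  toList (v Vec.++ (w Vec.++ reverse v))
    ≡⟨ Vec.toList-++ v (w Vec.++ reverse v) ⟩
  toList v List.++ toList (w Vec.++ reverse v)
    ≡⟨ cong (toList v List.++_) (Vec.toList-++ w (reverse v)) ⟩
  toList v List.++ (toList w List.++ toList (reverse v))
    ≡⟨ cong (λ r → toList v List.++ (toList w List.++ r)) (Vec.toList-reverse v) ⟩
  toList v List.++ (toList w List.++ List.reverse (toList v)) ∎
  where open ≡-Reasoning

toList-injective : ∀ {A : Set} {n} (xs ys : Vec A n) → toList xs ≡ toList ys → xs ≡ ys
toList-injective xs ys eq = trans (sym (cast-is-id refl xs)) (Vec.toList-injective refl xs ys eq)

reverse-++₃ : ∀ {A : Set} {k j} (v : Vec A k) (w : Vec A j) (u : Vec A k) →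
  reverse (v Vec.++ (w Vec.++ u)) ≡ reverse u Vec.++ (reverse w Vec.++ reverse v)
reverse-++₃ v w u = toList-injective _ _ (begin
  toList (reverse (v Vec.++ (w Vec.++ u)))
    ≡⟨ Vec.toList-reverse (v Vec.++ (w Vec.++ u)) ⟩
  List.reverse (toList (v Vec.++ (w Vec.++ u)))
    ≡⟨ cong List.reverse (trans (Vec.toList-++ v (w Vec.++ u)) (cong (V List.++_) (Vec.toList-++ w u))) ⟩
  List.reverse (V List.++ (W List.++ U))
    ≡⟨ List.reverse-++ V (W List.++ U) ⟩
  List.reverse (W List.++ U) List.++ List.reverse V
    ≡⟨ cong (List._++ List.reverse V) (List.reverse-++ W U) ⟩
  (List.reverse U List.++ List.reverse W) List.++ List.reverse V
    ≡⟨ List.++-assoc (List.reverse U) (List.reverse W) (List.reverse V) ⟩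
  List.reverse U List.++ (List.reverse W List.++ List.reverse V)
    ≡⟨ cong₂ (λ a b → a List.++ (b List.++ List.reverse V)) (Vec.toList-reverse u) (Vec.toList-reverse w) ⟨
  toList (reverse u) List.++ (toList (reverse w) List.++ List.reverse V)
    ≡⟨ cong (λ c → toList (reverse u) List.++ (toList (reverse w) List.++ c)) (Vec.toList-reverse v) ⟨
  toList (reverse u) List.++ (toList (reverse w) List.++ toList (reverse v))
    ≡⟨ cong (toList (reverse u) List.++_) (Vec.toList-++ (reverse w) (reverse v)) ⟨
  toList (reverse u) List.++ toList (reverse w Vec.++ reverse v)
    ≡⟨ Vec.toList-++ (reverse u) (reverse w Vec.++ reverse v) ⟨
  toList (reverse u Vec.++ (reverse w Vec.++ reverse v)) ∎)
  where
  open ≡-Reasoning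
  V = toList v
  W = toList w
  U = toList u

selfTwin-mirror : ∀ {j k} (w : Vec Bool j) (v : Vec Bool k) → SelfTwin w → SelfTwin (mirror w v)
selfTwin-mirror w v w-twin = begin
  reverse (v Vec.++ (w Vec.++ reverse v))
    ≡⟨ reverse-++₃ v w (reverse v) ⟩
  reverse (reverse v) Vec.++ (reverse w Vec.++ reverse v)
    ≡⟨ cong₂ (λ a b → a Vec.++ (b Vec.++ reverse v)) (Vec.reverse-involutive v) w-twin ⟩
  v Vec.++ (w Vec.++ reverse v) ∎
  where open ≡-Reasoning

-- Conversely, every self twin vector of length k + (j + k) is a mirror image:
-- cut it into pieces v, w, u of lengths k, j, k and compare with its reverse.
selfTwin-decompose : ∀ {j} k (z : Vec Bool (k + (j + k))) → SelfTwin z →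
  ∃₂ λ (w : Vec Bool j) v → SelfTwin w × z ≡ mirror w v
selfTwin-decompose {j} k z z-twin
  with v , wu , refl ← Vec.splitAt k z
  with w , u , refl ← Vec.splitAt j wu
  with u-v , wu-twin ← Vec.++-injective (reverse u) v (trans (sym (reverse-++₃ v w u)) z-twin)
  with w-twin , v-u ← Vec.++-injective (reverse w) w wu-twin
  = w , v , w-twin , cong (λ r → v Vec.++ (w Vec.++ r)) (sym v-u)

ones-around : ∀ ws vs → ones (ws List.++ List.reverse vs) ≡ ones ws + ones vs
ones-around ws vs = begin
  ones (ws List.++ List.reverse vs)     ≡⟨ ones-++ ws (List.reverse vs) ⟩
  ones ws + ones (List.reverse vs)      ≡⟨ cong (λ n → ones ws + n) (ones-reverse vs) ⟩
  ones ws + ones vs                     ∎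
  where open ≡-Reasoning

length-freeTypes-mirror : ∀ {j k} (w : Vec Bool j) (v : Vec Bool k) →
  length (freeTypeRep (mirror w v)) ≡ ones (toList v) + suc (ones (toList w) + ones (toList v))
length-freeTypes-mirror w v = begin
  length (freeTypes (toList (mirror w v)))
    ≡⟨ cong (length ∘′ freeTypes) (toList-mirror w v) ⟩
  length (freeTypes (L List.++ R))
    ≡⟨ cong length (freeTypes-shape (L List.++ R)) ⟩
  length (shape 2 (L List.++ R))
    ≡⟨ length-shape-++ 2 L R ⟩
  ones L + suc (ones R)
    ≡⟨ cong (λ n → ones L + suc n) (ones-around W L) ⟩
  ones L + suc (ones W + ones L) ∎
  where
  open ≡-Reasoning
  L = toList v
  W = toList w
  R = W List.++ List.reverse L

oddFree-mirror : ∀ {j k} (w : Vec Bool j) (v : Vec Bool k) → ones (toList w) ≡ 0 → OddFree (mirror w v)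
oddFree-mirror w v no-ones = begin
  length (freeTypeRep (mirror w v)) % 2
    ≡⟨ cong (_% 2) (length-freeTypes-mirror w v) ⟩
  (a + suc (ones (toList w) + a)) % 2
    ≡⟨ cong (λ n → (a + suc (n + a)) % 2) no-ones ⟩
  (a + suc a) % 2
    ≡⟨ odd-parity a ⟩
  1 ∎
  where
  open ≡-Reasoning
  a = ones (toList v)

not-oddFree-mirror-true : ∀ {k} (v : Vec Bool k) → ¬ OddFree (mirror (true ∷ []) v)
not-oddFree-mirror-true v odd = 0≢1+n (begin
  0                                                    ≡⟨ even-parity (ones (toList v)) ⟨
  (ones (toList v) + suc (suc (ones (toList v)))) % 2  ≡⟨ cong (_% 2) (length-freeTypes-mirror (true ∷ []) v) ⟨
  length (freeTypeRep (mirror (true ∷ []) v)) % 2      ≡⟨ odd ⟩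
  1                                                    ∎)
  where open ≡-Reasoning

pivot-mirror : ∀ {j k} (w : Vec Bool j) (v : Vec Bool k) → ones (toList w) ≡ 0 →
  pivot (mirror w v) ≡ firstBlock (openBlock 2 (toList v)) (toList w List.++ List.reverse (toList v))
pivot-mirror w v no-ones = begin
  middle (freeTypes (toList (mirror w v)))
    ≡⟨ cong middle (trans (cong freeTypes (toList-mirror w v)) (freeTypes-shape (L List.++ R))) ⟩
  middle (shape 2 (L List.++ R))
    ≡⟨ middle-balanced L R balanced ⟩
  firstBlock (openBlock 2 L) R ∎
  where
  open ≡-Reasoning
  L = toList v
  R = toList w List.++ List.reverse L
  balanced : ones R ≡ ones L
  balanced = trans (ones-around (toList w) L) (cong (_+ ones L) no-ones)

-- Inserting a 0 at the centre of a mirror image enlarges the central block,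
-- i.e. raises the pivot by one.
pivot-insert-zero : ∀ {k} (v : Vec Bool k) → pivot (mirror (false ∷ []) v) ≡ suc (pivot (mirror [] v))
pivot-insert-zero v = begin
  pivot (mirror (false ∷ []) v)  ≡⟨ pivot-mirror (false ∷ []) v refl ⟩
  firstBlock (suc o) R           ≡⟨ firstBlock-suc o R ⟩
  suc (firstBlock o R)           ≡⟨ cong suc (pivot-mirror [] v refl) ⟨
  suc (pivot (mirror [] v))      ∎
  where
  open ≡-Reasoning
  o = openBlock 2 (toList v)
  R = List.reverse (toList v)

-- The two one-bit extensions of a vector; by definition
-- allVecs (suc n) = concatMap extensions (allVecs n).
extensions : ∀ {n} → Vec Bool n → List (Vec Bool (suc n))
extensions v = (false ∷ v) ∷ (true ∷ v) ∷ []

allVecs-complete : ∀ {n} (v : Vec Bool n) → v ∈ allVecs n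
allVecs-complete []      = here refl
allVecs-complete (b ∷ v) = ∈-concatMap⁺ extensions (Any.map (λ { refl → bit b }) (allVecs-complete v))
  where
  bit : ∀ b → b ∷ v ∈ extensions v
  bit false = here refl
  bit true  = there (here refl)

allVecs-unique : ∀ n → Unique (allVecs n)
allVecs-unique zero    = [] ∷ []
allVecs-unique (suc n) = extend (allVecs-unique n)
  where
  prefix-∈ : ∀ {b v xs} → b ∷ v ∈ List.concatMap extensions xs → v ∈ xs
  prefix-∈ mem =
    Any.map (λ { (here refl) → refl ; (there (here refl)) → refl }) (∈-concatMap⁻ extensions mem)

  extend : ∀ {xs} → Unique xs → Unique (List.concatMap extensions xs)
  extend []                      = []
  extend {x ∷ xs} (x∉xs ∷ xs-unique) = ((λ ()) ∷ fresh false) ∷ fresh true ∷ extend xs-unique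
    where
    fresh : ∀ b → All (b ∷ x ≢_) (List.concatMap extensions xs)
    fresh b = ¬Any⇒All¬ _ (All¬⇒¬Any x∉xs ∘′ prefix-∈)

enumerate : ∀ {k n} {P : Vec Bool n → Set} (P? : Decidable P) (f : Vec Bool k → Vec Bool n) →
  Injective _≡_ _≡_ f → (∀ v → P (f v)) → (∀ z → P z → ∃ λ v → f v ≡ z) →
  filter P? (allVecs n) ↭ map f (allVecs k)
enumerate {k} {n} P? f f-injective image-P P-image =
  ∼bag⇒↭ (unique∧set⇒bag (Unique.filter⁺ P? (allVecs-unique n))
                          (Unique.map⁺ f-injective (allVecs-unique k))
                          (mk⇔ listed produced))
  where
  listed : ∀ {z} → z ∈ filter P? (allVecs n) → z ∈ map f (allVecs k)
  listed {z} z∈ with v , refl ← P-image z (proj₂ (∈-filter⁻ P? {xs = allVecs n} z∈)) =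
    ∈-map⁺ f (allVecs-complete v)
  produced : ∀ {z} → z ∈ map f (allVecs k) → z ∈ filter P? (allVecs n)
  produced z∈ with v , _ , refl ← ∈-map⁻ f z∈ = ∈-filter⁺ P? (allVecs-complete (f v)) (image-P v)

mirror-injective : ∀ {j k} (w : Vec Bool j) → Injective _≡_ _≡_ (mirror {k = k} w)
mirror-injective w {v} {v′} eq = proj₁ (Vec.++-injective v v′ eq)

evenGeneration : ∀ k → filter SelfTwinOdd? (allVecs (k + k)) ↭ map (mirror []) (allVecs k)
evenGeneration k = enumerate SelfTwinOdd? (mirror []) (mirror-injective [])
  (λ v → selfTwin-mirror [] v refl , oddFree-mirror [] v refl)
  (λ z (z-twin , _) → case selfTwin-decompose k z z-twin of λ where
    ([] , v , _ , refl) → v , refl)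

-- Generation 2k + 1: the self twin games are the images v b v^R; the odd
-- free type length forces the centre bit b to be 0.
oddGeneration : ∀ k → filter SelfTwinOdd? (allVecs (k + suc k)) ↭ map (mirror (false ∷ [])) (allVecs k)
oddGeneration k = enumerate SelfTwinOdd? (mirror (false ∷ [])) (mirror-injective (false ∷ []))
  (λ v → selfTwin-mirror (false ∷ []) v refl , oddFree-mirror (false ∷ []) v refl)
  (λ z (z-twin , z-odd) → case selfTwin-decompose k z z-twin of λ where
    (false ∷ [] , v , _ , refl) → v , refl
    (true ∷ [] , v , _ , refl) → ⊥-elim (not-oddFree-mirror-true v z-odd))

pivots-shift : ∀ k → pivots (k + suc k) ↭ map suc (pivots (k + k))
pivots-shift k = begin
  map pivot (filter SelfTwinOdd? (allVecs (k + suc k)))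
    ↭⟨ map⁺ pivot (oddGeneration k) ⟩
  map pivot (map (mirror (false ∷ [])) halves)
    ≡⟨ List.map-∘ halves ⟨
  map (pivot ∘′ mirror (false ∷ [])) halves
    ≡⟨ List.map-cong pivot-insert-zero halves ⟩
  map (suc ∘′ pivot ∘′ mirror []) halves
    ≡⟨ trans (List.map-∘ halves) (cong (map suc) (List.map-∘ halves)) ⟩
  map suc (map pivot (map (mirror []) halves))
    ↭⟨ map⁺ suc (map⁺ pivot (evenGeneration k)) ⟨
  map suc (map pivot (filter SelfTwinOdd? (allVecs (k + k)))) ∎
  where
  open PermutationReasoning
  halves : List (Vec Bool k)
  halves = allVecs k

filter-map : ∀ {A B : Set} {Q : B → Set} (Q? : Decidable Q) (f : A → B) xs →
  filter Q? (map f xs) ≡ map f (filter (λ x → Q? (f x)) xs)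
filter-map Q? f []       = refl
filter-map Q? f (x ∷ xs) with Q? (f x)
... | yes _ = cong (f x ∷_) (filter-map Q? f xs)
... | no  _ = filter-map Q? f xs

filter-filter : ∀ {A : Set} {P Q : A → Set} (P? : Decidable P) (Q? : Decidable Q) xs →
  filter Q? (filter P? xs) ≡ filter (λ x → P? x ×-dec Q? x) xs
filter-filter P? Q? []       = refl
filter-filter P? Q? (x ∷ xs) with P? x
... | no  _ = filter-filter P? Q? xs
... | yes _ with Q? x
...   | yes _ = cong (x ∷_) (filter-filter P? Q? xs)
...   | no  _ = filter-filter P? Q? xs

occurrences : ℤ → List ℕ → ℕ
occurrences p xs = length (filter (λ x → + x ℤ.≟ p) xs)

countPivot-occurrences : ∀ n p → countPivot n p ≡ occurrences p (pivots n)
countPivot-occurrences n p = begin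
  length (filter (Counted? p) (allVecs n))
    ≡⟨ cong length (List.filter-≐ (Counted? p) (λ c → SelfTwinOdd? c ×-dec (+ pivot c ℤ.≟ p))
                     (assocˡ′ , assocʳ′) (allVecs n)) ⟩
  length (filter (λ c → SelfTwinOdd? c ×-dec (+ pivot c ℤ.≟ p)) (allVecs n))
    ≡⟨ cong length (filter-filter SelfTwinOdd? (λ c → + pivot c ℤ.≟ p) (allVecs n)) ⟨
  length (filter (λ c → + pivot c ℤ.≟ p) (filter SelfTwinOdd? (allVecs n)))
    ≡⟨ List.length-map pivot (filter (λ c → + pivot c ℤ.≟ p) (filter SelfTwinOdd? (allVecs n))) ⟨
  length (map pivot (filter (λ c → + pivot c ℤ.≟ p) (filter SelfTwinOdd? (allVecs n))))
    ≡⟨ cong length (filter-map (λ x → + x ℤ.≟ p) pivot (filter SelfTwinOdd? (allVecs n))) ⟨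
  occurrences p (pivots n) ∎
  where open ≡-Reasoning

occurrences-↭ : ∀ p {xs ys} → xs ↭ ys → occurrences p xs ≡ occurrences p ys
occurrences-↭ p xs↭ys = ↭-length (filter-↭ (λ x → + x ℤ.≟ p) xs↭ys)

shift-≐ : ∀ p → (λ x → + suc x ≡ p ℤ.+ 1ℤ) ≐ (λ x → + x ≡ p)
shift-≐ p = shift-down , shift-up
  where
  suc-+1 : ∀ i → ℤ.suc i ≡ i ℤ.+ 1ℤ
  suc-+1 i = ℤ.+-comm 1ℤ i
  shift-down : ∀ {x} → + suc x ≡ p ℤ.+ 1ℤ → + x ≡ p
  shift-down {x} eq = begin
    + x                       ≡⟨ ℤ.pred-suc (+ x) ⟨
    ℤ.pred (+ suc x)          ≡⟨ cong ℤ.pred (trans eq (sym (suc-+1 p))) ⟩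
    ℤ.pred (ℤ.suc p)          ≡⟨ ℤ.pred-suc p ⟩
    p                         ∎
    where open ≡-Reasoning
  shift-up : ∀ {x} → + x ≡ p → + suc x ≡ p ℤ.+ 1ℤ
  shift-up {x} refl = suc-+1 (+ x)

occurrences-suc : ∀ p xs → occurrences (p ℤ.+ 1ℤ) (map suc xs) ≡ occurrences p xs
occurrences-suc p xs = begin
  length (filter (λ x → + x ℤ.≟ p ℤ.+ 1ℤ) (map suc xs))
    ≡⟨ cong length (filter-map (λ x → + x ℤ.≟ p ℤ.+ 1ℤ) suc xs) ⟩
  length (map suc (filter (λ x → + suc x ℤ.≟ p ℤ.+ 1ℤ) xs))
    ≡⟨ List.length-map suc (filter (λ x → + suc x ℤ.≟ p ℤ.+ 1ℤ) xs) ⟩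
  length (filter (λ x → + suc x ℤ.≟ p ℤ.+ 1ℤ) xs)
    ≡⟨ cong length (List.filter-≐ _ (λ x → + x ℤ.≟ p) (shift-≐ p) xs) ⟩
  occurrences p xs ∎
  where open ≡-Reasoning

countPivot-shift : ∀ n n′ → pivots n′ ↭ map suc (pivots n) →
  ∀ p → countPivot n′ (p ℤ.+ 1ℤ) ≡ countPivot n p
countPivot-shift n n′ shifted p = begin
  countPivot n′ (p ℤ.+ 1ℤ)                   ≡⟨ countPivot-occurrences n′ (p ℤ.+ 1ℤ) ⟩
  occurrences (p ℤ.+ 1ℤ) (pivots n′)           ≡⟨ occurrences-↭ (p ℤ.+ 1ℤ) shifted ⟩
  occurrences (p ℤ.+ 1ℤ) (map suc (pivots n))  ≡⟨ occurrences-suc p (pivots n) ⟩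
  occurrences p (pivots n)                     ≡⟨ countPivot-occurrences n p ⟨
  countPivot n p                               ∎
  where open ≡-Reasoning

proposition7p2 : (m : ℕ) → Even m →
    ((p : ℤ) → countPivot (suc m) (p ℤ.+ 1ℤ) ≡ countPivot m p)
    × (pivots (suc m) ↭ map suc (pivots m))
proposition7p2 m (k , m≡2k) = countPivot-shift m (suc m) shifted , shifted
  where
  m≡k+k : m ≡ k + k
  m≡k+k = trans m≡2k (cong (λ n → k + n) (+-identityʳ k))
  1+m≡k+[1+k] : suc m ≡ k + suc k
  1+m≡k+[1+k] = trans (cong suc m≡k+k) (sym (+-suc k k))
  shifted : pivots (suc m) ↭ map suc (pivots m)
  shifted = subst₂ (λ n′ n → pivots n′ ↭ map suc (pivots n))
                   (sym 1+m≡k+[1+k]) (sym m≡k+k) (pivots-shift k)
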